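{- Let $A$ and $B=\{b_1,\dots,b_l\}$ be disjoint sets of propositional variables, and let $f=\bigwedge_{i=1}^l C_i$ be a propositional CNF formula over the variables $A$ whose clauses $C_i$ each have three literals. Let $f'=\bigwedge_{i=1}^l \bigl(C_i\wedge(b_i\vee b_i\vee b_i)\bigr)$. Then $f'$ is satisfiable if and only if $f$ is satisfiable. Moreover, for every subformula $(g\wedge h)$ of $f'$, the formulas $g$ and $h$ are strongly independent.
   Context: Conjunctions are regarded as binary, so every subformula of such a formula is either a clause or a conjunction $(g\wedge h)$ of two subformulas. For subformulas $g,h$, $g$ is called independent from $h$ if $g$ contains a clause all of whose variables do not occur in $h$; $g$ and $h$ are strongly independent if $g$ is independent from $h$ and $h$ is independent from $g$. -}

module Defs where

open import Data.Nat using (ℕ; _+_)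
open import Data.Bool using (Bool; true; false; not; _∨_; _∧_)
open import Data.List using (List; []; _∷_; _++_)
open import Data.List.Membership.Propositional using (_∈_; _∉_)
open import Data.List.Relation.Unary.All using (All)
open import Data.Vec using (Vec; []; _∷_; take; drop)
open import Data.Product using (Σ; _×_; _,_)
open import Relation.Binary.PropositionalEquality using (_≡_)

Var : Set
Var = ℕ

data Literal : Set where
  pos : Var → Literal
  neg : Var → Literal

litVar : Literal → Var
litVar (pos v) = v
litVar (neg v) = v

record Clause : Set where
  constructor ⟨_,_,_⟩
  field
    l₁ l₂ l₃ : Literal

clauseVars : Clause → List Var
clauseVars ⟨ a , b , c ⟩ = litVar a ∷ litVar b ∷ litVar c ∷ []

data Formula : Set where
  cl   : Clause → Formula
  _⋀_  : Formula → Formula → Formula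

infixr 5 _⋀_

clauses : Formula → List Clause
clauses (cl c)  = c ∷ []
clauses (g ⋀ h) = clauses g ++ clauses h

vars : Formula → List Var
vars (cl c)  = clauseVars c
vars (g ⋀ h) = vars g ++ vars h

size : Formula → ℕ
size (cl c)  = 1
size (g ⋀ h) = size g + size h

Assignment : Set
Assignment = Var → Bool

evalLit : Assignment → Literal → Bool
evalLit σ (pos v) = σ v
evalLit σ (neg v) = not (σ v)

evalClause : Assignment → Clause → Bool
evalClause σ ⟨ a , b , c ⟩ = evalLit σ a ∨ evalLit σ b ∨ evalLit σ c

eval : Assignment → Formula → Bool
eval σ (cl c)  = evalClause σ c
eval σ (g ⋀ h) = eval σ g ∧ eval σ h

Satisfiable : Formula → Set
Satisfiable f = Σ Assignment (λ σ → eval σ f ≡ true)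

data _⊑_ : Formula → Formula → Set where
  here  : ∀ {f} → f ⊑ f
  left  : ∀ {f g h} → f ⊑ g → f ⊑ (g ⋀ h)
  right : ∀ {f g h} → f ⊑ h → f ⊑ (g ⋀ h)

Independent : Formula → Formula → Set
Independent g h = Σ Clause (λ c → c ∈ clauses g × All (λ v → v ∉ vars h) (clauseVars c))

StronglyIndependent : Formula → Formula → Set
StronglyIndependent g h = Independent g h × Independent h g

triple : Var → Clause
triple b = ⟨ pos b , pos b , pos b ⟩

-- f' : the i-th clause C_i of f (in left-to-right order) is replaced by
-- (C_i ∧ (b_i ∨ b_i ∨ b_i)), keeping the conjunction structure of f.
extend : (f : Formula) → Vec Var (size f) → Formula
extend (cl c)  (b ∷ []) = cl c ⋀ cl (triple b)
extend (g ⋀ h) bs       = extend g (take (size g) bs) ⋀ extend h (drop (size g) bs)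

-- Satisfiability: an assignment satisfying f can be raised to true on the fresh
-- variables b without changing its values on the variables of f, and then it
-- satisfies every added clause (b_i ∨ b_i ∨ b_i). Strong independence: every
-- subformula g ∧ h of f' is either C_i ∧ (b_i ∨ b_i ∨ b_i), or a conjunction of
-- extensions of two disjoint parts of f. In the latter case each side contains
-- a clause (b ∨ b ∨ b) with b in its own block of fresh variables; b does not
-- occur on the other side, whose variables lie in A or in the other block.
module Submission where

open import Defs
open import Data.Nat using (zero; suc; _+_; _≟_)
open import Data.Bool using (true; not; _∨_; _∧_)
open import Data.Bool.Properties using (∨-identityʳ; ∨-zeroʳ; ∧-identityʳ)
open import Data.Vec using (Vec; []; _∷_; take; drop)
open import Data.Vec.Relation.Unary.Any using (here; there)
open import Data.Vec.Relation.Unary.AllPairs using ([]; _∷_)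
open import Data.Vec.Relation.Unary.Unique.Propositional using (Unique)
import Data.Vec.Relation.Unary.Unique.Propositional.Properties as Unique
import Data.Vec.Relation.Unary.All as VAll
import Data.Vec.Relation.Unary.All.Properties as VAll
open import Data.Vec.Membership.Propositional using () renaming (_∈_ to _∈ᵥ_; _∉_ to _∉ᵥ_)
open import Data.Vec.Membership.DecPropositional _≟_ using (_∈?_)
open import Data.List.Relation.Unary.All using (All; []; _∷_)
import Data.List.Relation.Unary.All as LAll
open import Data.List.Relation.Unary.All.Properties using (++⁺; ++⁻ˡ; ++⁻ʳ; All¬⇒¬Any)
open import Data.List.Relation.Unary.Any using (here; there)
open import Data.List.Membership.Propositional using (_∈_; _∉_)
open import Data.List.Membership.Propositional.Properties using (∈-++⁺ˡ)
open import Data.Product using (_×_; _,_; proj₁; ∃)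
open import Function.Bundles using (_⇔_; mk⇔)
open import Relation.Nullary using (¬_; does)
open import Relation.Nullary.Decidable using (dec-true; dec-false)
open import Relation.Binary.PropositionalEquality
  using (_≡_; _≢_; refl; cong; cong₂; ≢-sym; module ≡-Reasoning)

∈ᵥ-self : ∀ {n} (xs : Vec Var n) → VAll.All (_∈ᵥ xs) xs
∈ᵥ-self []       = VAll.[]
∈ᵥ-self (x ∷ xs) = here refl VAll.∷ VAll.map there (∈ᵥ-self xs)

take-drop-apart : ∀ m {n} {xs : Vec Var (m + n)} → Unique xs →
                  VAll.All (λ x → VAll.All (x ≢_) (drop m xs)) (take m xs)
take-drop-apart zero    _                     = VAll.[]
take-drop-apart (suc m) {xs = x ∷ _} (x∉ ∷ u) = VAll.drop⁺ m x∉ VAll.∷ take-drop-apart m u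

drop-take-apart : ∀ m {n} {xs : Vec Var (m + n)} → Unique xs →
                  VAll.All (λ x → VAll.All (x ≢_) (take m xs)) (drop m xs)
drop-take-apart m u = VAll.map (VAll.map ≢-sym) (VAll.All-swap (take-drop-apart m u))

vars-extend⁺ : ∀ {P : Var → Set} f bs → All P (vars f) → VAll.All P bs → All P (vars (extend f bs))
vars-extend⁺ (cl c)  (b ∷ []) Pc (Pb VAll.∷ VAll.[]) = ++⁺ Pc (Pb ∷ Pb ∷ Pb ∷ [])
vars-extend⁺ (g ⋀ h) bs       Pf Pbs =
  ++⁺ (vars-extend⁺ g _ (++⁻ˡ (vars g) Pf) (VAll.take⁺ (size g) Pbs))
      (vars-extend⁺ h _ (++⁻ʳ (vars g) Pf) (VAll.drop⁺ (size g) Pbs))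

triple-∈-extend : ∀ {P : Var → Set} f bs → VAll.All P bs → ∃ λ x → P x × triple x ∈ clauses (extend f bs)
triple-∈-extend (cl c)  (b ∷ []) (Pb VAll.∷ VAll.[]) = b , Pb , there (here refl)
triple-∈-extend (g ⋀ h) bs       Pbs with triple-∈-extend g _ (VAll.take⁺ (size g) Pbs)
... | x , Px , x∈g = x , Px , ∈-++⁺ˡ x∈g

extend-independent : ∀ f bs h → VAll.All (_∉ vars h) bs → Independent (extend f bs) h
extend-independent f bs h fresh with triple-∈-extend f bs fresh
... | x , x∉h , t∈f = triple x , t∈f , x∉h ∷ x∉h ∷ x∉h ∷ []

module _ {A B : Var → Set} (A∩B=∅ : ∀ v → A v → ¬ B v) where

  A≢B : ∀ {v x} → A v → B x → v ≢ x
  A≢B Av Bv refl = A∩B=∅ _ Av Bv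

  ∉-extend : ∀ {x} f bs → All A (vars f) → B x → VAll.All (x ≢_) bs → x ∉ vars (extend f bs)
  ∉-extend f bs Af Bx x≢bs =
    All¬⇒¬Any (vars-extend⁺ f bs (LAll.map (λ Av → ≢-sym (A≢B Av Bx)) Af) x≢bs)

  extend-apart-independent : ∀ f₁ bs₁ f₂ bs₂ → VAll.All B bs₁ → All A (vars f₂) →
                             VAll.All (λ x → VAll.All (x ≢_) bs₂) bs₁ →
                             Independent (extend f₁ bs₁) (extend f₂ bs₂)
  extend-apart-independent f₁ bs₁ f₂ bs₂ Bbs₁ Af₂ apart =
    extend-independent f₁ bs₁ (extend f₂ bs₂)
      (VAll.map (λ { (Bx , x≢bs₂) → ∉-extend f₂ bs₂ Af₂ Bx x≢bs₂ }) (VAll.zip (Bbs₁ , apart)))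

  extend-strongly-independent : ∀ f bs → All A (vars f) → VAll.All B bs → Unique bs →
                                ∀ {g h} → (g ⋀ h) ⊑ extend f bs → StronglyIndependent g h
  extend-strongly-independent (cl c) (b ∷ []) Ac (Bb VAll.∷ VAll.[]) _ here =
    (c , here refl , LAll.map (λ Av → All¬⇒¬Any (A≢B Av Bb ∷ A≢B Av Bb ∷ A≢B Av Bb ∷ [])) Ac) ,
    (triple b , here refl , b∉c ∷ b∉c ∷ b∉c ∷ [])
    where
    b∉c : b ∉ clauseVars c
    b∉c = All¬⇒¬Any (LAll.map (λ Av → ≢-sym (A≢B Av Bb)) Ac)
  extend-strongly-independent (cl c)    (b ∷ []) _ _ _ (left ())
  extend-strongly-independent (cl c)    (b ∷ []) _ _ _ (right ())
  extend-strongly-independent (f₁ ⋀ f₂) bs Af Bbs u here =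
    extend-apart-independent f₁ _ f₂ _ (VAll.take⁺ (size f₁) Bbs) (++⁻ʳ (vars f₁) Af) (take-drop-apart (size f₁) u) ,
    extend-apart-independent f₂ _ f₁ _ (VAll.drop⁺ (size f₁) Bbs) (++⁻ˡ (vars f₁) Af) (drop-take-apart (size f₁) u)
  extend-strongly-independent (f₁ ⋀ f₂) bs Af Bbs u (left p) =
    extend-strongly-independent f₁ _ (++⁻ˡ (vars f₁) Af) (VAll.take⁺ (size f₁) Bbs) (Unique.take⁺ (size f₁) u) p
  extend-strongly-independent (f₁ ⋀ f₂) bs Af Bbs u (right p) =
    extend-strongly-independent f₂ _ (++⁻ʳ (vars f₁) Af) (VAll.drop⁺ (size f₁) Bbs) (Unique.drop⁺ (size f₁) u) p

∧-true⁻ : ∀ {a b} → a ∧ b ≡ true → a ≡ true × b ≡ true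
∧-true⁻ {true} {true} refl = refl , refl

evalLit-cong : ∀ {σ τ} l → σ (litVar l) ≡ τ (litVar l) → evalLit σ l ≡ evalLit τ l
evalLit-cong (pos v) e = e
evalLit-cong (neg v) e = cong not e

eval-cong : ∀ {σ τ} f → All (λ v → σ v ≡ τ v) (vars f) → eval σ f ≡ eval τ f
eval-cong (cl ⟨ a , b , c ⟩) (ea ∷ eb ∷ ec ∷ []) =
  cong₂ _∨_ (evalLit-cong a ea) (cong₂ _∨_ (evalLit-cong b eb) (evalLit-cong c ec))
eval-cong (g ⋀ h) e = cong₂ _∧_ (eval-cong g (++⁻ˡ (vars g) e)) (eval-cong h (++⁻ʳ (vars g) e))

eval-extend : ∀ {σ} f bs → VAll.All (λ x → σ x ≡ true) bs → eval σ (extend f bs) ≡ eval σ f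
eval-extend (cl c)  (b ∷ []) (σb VAll.∷ VAll.[]) rewrite σb = ∧-identityʳ _
eval-extend (g ⋀ h) bs       σbs =
  cong₂ _∧_ (eval-extend g _ (VAll.take⁺ (size g) σbs)) (eval-extend h _ (VAll.drop⁺ (size g) σbs))

extend-true⇒true : ∀ σ f bs → eval σ (extend f bs) ≡ true → eval σ f ≡ true
extend-true⇒true σ (cl c)  (b ∷ []) sat = proj₁ (∧-true⁻ sat)
extend-true⇒true σ (g ⋀ h) bs       sat with ∧-true⁻ {eval σ (extend g _)} sat
... | satg , sath = cong₂ _∧_ (extend-true⇒true σ g _ satg) (extend-true⇒true σ h _ sath)

raise : ∀ {n} → Vec Var n → Assignment → Assignment
raise bs σ v = σ v ∨ does (v ∈? bs)

raise-∈ : ∀ {n} {bs : Vec Var n} σ {x} → x ∈ᵥ bs → raise bs σ x ≡ true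
raise-∈ {bs = bs} σ {x} x∈ rewrite dec-true (x ∈? bs) x∈ = ∨-zeroʳ (σ x)

raise-∉ : ∀ {n} {bs : Vec Var n} σ {v} → v ∉ᵥ bs → raise bs σ v ≡ σ v
raise-∉ {bs = bs} σ {v} v∉ rewrite dec-false (v ∈? bs) v∉ = ∨-identityʳ (σ v)

extend-satisfiable⇔ : ∀ f bs → All (_∉ᵥ bs) (vars f) → Satisfiable (extend f bs) ⇔ Satisfiable f
extend-satisfiable⇔ f bs fresh = mk⇔
  (λ { (σ , sat) → σ , extend-true⇒true σ f bs sat })
  (λ { (σ , sat) → raise bs σ , raised-sat σ sat })
  where
  open ≡-Reasoning
  raised-sat : ∀ σ → eval σ f ≡ true → eval (raise bs σ) (extend f bs) ≡ true
  raised-sat σ sat = begin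
    eval (raise bs σ) (extend f bs) ≡⟨ eval-extend f bs (VAll.map (raise-∈ σ) (∈ᵥ-self bs)) ⟩
    eval (raise bs σ) f             ≡⟨ eval-cong f (LAll.map (raise-∉ σ) fresh) ⟩
    eval σ f                        ≡⟨ sat ⟩
    true                            ∎

lemma1 : (A B : Var → Set) → (∀ v → A v → ¬ B v) →
         (f : Formula) → All A (vars f) →
         (b : Vec Var (size f)) → Unique b → VAll.All B b →
         (Satisfiable (extend f b) ⇔ Satisfiable f)
         × (∀ g h → (g ⋀ h) ⊑ extend f b → StronglyIndependent g h)
lemma1 A B A∩B=∅ f Af b u Bb =
  extend-satisfiable⇔ f b (LAll.map (λ Av v∈b → A∩B=∅ _ Av (VAll.lookup Bb v∈b)) Af) ,
  λ g h → extend-strongly-independent A∩B=∅ f b Af Bb u
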